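{- Let $r \ge 1$ and let $rK_2$ denote the graph consisting of $r$ pairwise disjoint edges. In every $r$-lettering of $rK_2$, each letter encodes exactly the two vertices of one of the $r$ edges (i.e., of one copy of $K_2$).
   Context: Given a finite alphabet $\Sigma$, a set $D \subseteq \Sigma^2$ (the decoder), and a word $w = w_1 \dots w_n$ with each $w_i \in \Sigma$, the letter graph $\Gamma_D(w)$ is the simple graph with vertex set $\{1,\dots,n\}$ in which, for $p < q$, the vertices $p$ and $q$ are adjacent if and only if $(w_p, w_q) \in D$. A lettering of a graph $G$ is a letter graph $\Gamma_D(w)$ isomorphic to $G$; an $r$-lettering is one where the word $w$ uses an alphabet of size $r$. In a letter graph $\Gamma_D(w)$, a letter $a \in \Sigma$ encodes the set of vertices $\{i : w_i = a\}$. -}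

module Defs where

open import Data.Nat using (ℕ; _<_)
open import Data.Fin using (Fin; toℕ)
open import Data.Product using (_×_; proj₁; proj₂; Σ; ∃)
open import Data.Sum using (_⊎_)
open import Relation.Binary.PropositionalEquality using (_≡_; _≢_)
open import Function.Bundles using (_↔_; Inverse)

-- A decoder over the alphabet Fin r is a subset D ⊆ Σ², given as a relation.
Decoder : ℕ → Set₁
Decoder r = Fin r → Fin r → Set

LetterAdj : ∀ {r n} → Decoder r → (Fin n → Fin r) → Fin n → Fin n → Set
LetterAdj D w p q =
  (toℕ p < toℕ q × D (w p) (w q)) ⊎ (toℕ q < toℕ p × D (w q) (w p))

-- The graph rK₂: vertices (i , b), i : Fin r the edge index, b : Fin 2 the endpoint;
-- (i , b) ~ (j , c) iff i = j and b ≠ c.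
rK₂Vertex : ℕ → Set
rK₂Vertex r = Fin r × Fin 2

rK₂Adj : ∀ {r} → rK₂Vertex r → rK₂Vertex r → Set
rK₂Adj u v = (proj₁ u ≡ proj₁ v) × (proj₂ u ≢ proj₂ v)

record IsoToRK₂ {r n : ℕ} (D : Decoder r) (w : Fin n → Fin r) : Set where
  field
    bij : Fin n ↔ rK₂Vertex r
  field
    preserves : ∀ p q → (LetterAdj D w p q → rK₂Adj (Inverse.to bij p) (Inverse.to bij q))
    reflects   : ∀ p q → (rK₂Adj (Inverse.to bij p) (Inverse.to bij q) → LetterAdj D w p q)

-- Let Γ_D(w) ≅ rK₂ via f, so every vertex p has exactly one neighbour, its
-- partner.  The basic observation about letter graphs is that two vertices
-- with the same letter look the same from any vertex lying on the same side
-- of both (sameLetter-below/above).  In a graph of maximum degree one this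
-- forces: if p < q carry the same letter and are not adjacent, every
-- neighbour of p or of q lies strictly between them (partner-between).
-- The argument then runs in four steps:
--   1. no letter occurs three times (no-three-occurrences);
--   2. hence p ↦ (w p , "w p occurred earlier") is an injection of the 2r
--      vertices into Fin r × Fin 2, so by pigeonhole it is onto and every
--      letter occurs at least twice (second-occurrence);
--   3. two occurrences of a letter are adjacent: a non-adjacent pair
--      p < q yields one starting strictly before p (bad-descent), which is
--      impossible by well-founded induction (sameLetter⇒sameEdge);
--   4. an edge of rK₂ has only two vertices, which gives lemma3.
module Submission where

open import Defs
open import Data.Nat using (ℕ; _≥_)
open import Data.Nat.Properties using (1+n≰n)
open import Data.Fin using (Fin; zero; suc; punchOut; _<_)
open import Data.Fin.Properties
  using (_≟_; any?; <-cmp; <-trans; <⇒≢; <-asym; _<?_; injective⇒≤; punchOut-injective)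
open import Data.Fin.Induction using (<-wellFounded)
open import Data.Product using (∃; _×_; proj₁; proj₂; _,_)
open import Data.Sum using (_⊎_; inj₁; inj₂; [_,_]; map)
open import Data.Empty using (⊥; ⊥-elim)
open import Function using (_∘_)
open import Function.Bundles using (_⇔_; _↔_; Inverse; mk⇔)
open import Function.Definitions using (Injective; StrictlySurjective)
open import Induction.WellFounded using (Acc; acc)
open import Relation.Binary.Definitions using (tri<; tri≈; tri>)
open import Relation.Binary.PropositionalEquality
  using (_≡_; _≢_; refl; sym; trans; cong; cong₂; subst; module ≡-Reasoning)
open import Relation.Nullary using (¬_; Dec; yes; no; contradiction)
open import Relation.Nullary.Decidable using (_×-dec_)

retraction⇒injective : ∀ {A B : Set} (h : A → B) (k : B → A)
  → (∀ x → k (h x) ≡ x) → Injective _≡_ _≡_ h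
retraction⇒injective h k kh {x} {y} eq = begin
  x        ≡⟨ sym (kh x) ⟩
  k (h x)  ≡⟨ cong k eq ⟩
  k (h y)  ≡⟨ kh y ⟩
  y        ∎
  where open ≡-Reasoning

-- Pigeonhole: an injective endomap of Fin N is onto.  A missed value k would
-- let us squeeze the map into Fin (N - 1) injectively.
injective⇒onto : ∀ {N} (g : Fin N → Fin N) → Injective _≡_ _≡_ g → StrictlySurjective _≡_ g
injective⇒onto {ℕ.zero} g _ ()
injective⇒onto {ℕ.suc N} g g-inj k with any? (λ i → g i ≟ k)
... | yes hit = hit
... | no miss = contradiction (injective⇒≤ squeezed-inj) 1+n≰n
  where
  avoids : ∀ i → k ≢ g i
  avoids i eq = miss (i , sym eq)
  squeezed : Fin (ℕ.suc N) → Fin N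
  squeezed i = punchOut (avoids i)
  squeezed-inj : Injective _≡_ _≡_ squeezed
  squeezed-inj eq = g-inj (punchOut-injective (avoids _) (avoids _) eq)

injective-into-equinumerous⇒onto : ∀ {n} {B : Set} (e : Fin n ↔ B) (h : Fin n → B)
  → Injective _≡_ _≡_ h → StrictlySurjective _≡_ h
injective-into-equinumerous⇒onto e h h-inj b =
  let p , eq = injective⇒onto (from ∘ h) (h-inj ∘ from-inj) (from b) in p , from-inj eq
  where
  open Inverse e using (to; from; strictlyInverseˡ)
  from-inj : Injective _≡_ _≡_ from
  from-inj = retraction⇒injective from to strictlyInverseˡ

fin2-third : (x y z : Fin 2) → y ≢ z → x ≡ y ⊎ x ≡ z
fin2-third zero       zero       _          _   = inj₁ refl
fin2-third zero       (suc zero) zero       _   = inj₂ refl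
fin2-third (suc zero) (suc zero) _          _   = inj₁ refl
fin2-third (suc zero) zero       (suc zero) _   = inj₂ refl
fin2-third _          zero       zero       y≢z = contradiction refl y≢z
fin2-third _          (suc zero) (suc zero) y≢z = contradiction refl y≢z

flip : Fin 2 → Fin 2
flip zero    = suc zero
flip (suc _) = zero

flip-≢ : (b : Fin 2) → b ≢ flip b
flip-≢ zero       ()
flip-≢ (suc zero) ()

indicator : {P : Set} → Dec P → Fin 2
indicator (yes _) = suc zero
indicator (no _)  = zero

indicator-yes : {P : Set} (d : Dec P) → P → indicator d ≡ suc zero
indicator-yes (yes _) _ = refl
indicator-yes (no ¬p) p = contradiction p ¬p

indicator-one : {P : Set} (d : Dec P) → indicator d ≡ suc zero → P
indicator-one (yes p) _ = p
indicator-one (no _)  ()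

module Lettering {r n : ℕ} (D : Decoder r) (w : Fin n → Fin r) (φ : IsoToRK₂ D w) where
  open IsoToRK₂ φ

  f : Fin n → rK₂Vertex r
  f = Inverse.to bij

  f-injective : Injective _≡_ _≡_ f
  f-injective = retraction⇒injective f (Inverse.from bij) (Inverse.strictlyInverseʳ bij)

  edge : Fin n → Fin r
  edge p = proj₁ (f p)

  Adj : Fin n → Fin n → Set
  Adj p q = rK₂Adj (f p) (f q)

  adj-sym : ∀ {p q} → Adj p q → Adj q p
  adj-sym (same , differ) = sym same , differ ∘ sym

  adj-irrefl : ∀ {p} → ¬ Adj p p
  adj-irrefl (_ , differ) = differ refl

  adj-unique : ∀ {p x y} → Adj p x → Adj p y → x ≡ y
  adj-unique {p} {x} {y} (px , p≢x) (py , p≢y) =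
    f-injective (cong₂ _,_ (trans (sym px) py) sameSide)
    where
    sameSide : proj₂ (f x) ≡ proj₂ (f y)
    sameSide with fin2-third (proj₂ (f y)) (proj₂ (f p)) (proj₂ (f x)) p≢x
    ... | inj₁ y≡p = contradiction (sym y≡p) p≢y
    ... | inj₂ y≡x = sym y≡x

  partner : Fin n → Fin n
  partner p = Inverse.from bij (edge p , flip (proj₂ (f p)))

  partner-adj : ∀ p → Adj p (partner p)
  partner-adj p =
    subst (rK₂Adj (f p)) (sym (Inverse.strictlyInverseˡ bij _)) (refl , flip-≢ (proj₂ (f p)))

  edge-pair : ∀ {p s t} → edge p ≡ edge s → edge t ≡ edge s → t ≢ s → p ≡ s ⊎ p ≡ t
  edge-pair {p} {s} {t} ps ts t≢s =
    map (λ eq → f-injective (cong₂ _,_ ps eq))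
        (λ eq → f-injective (cong₂ _,_ (trans ps (sym ts)) eq))
        (fin2-third (proj₂ (f p)) (proj₂ (f s)) (proj₂ (f t)) sides-differ)
    where
    sides-differ : proj₂ (f s) ≢ proj₂ (f t)
    sides-differ eq = t≢s (f-injective (cong₂ _,_ ts (sym eq)))

  D⇒adj : ∀ {p q} → p < q → D (w p) (w q) → Adj p q
  D⇒adj {p} {q} p<q d = preserves p q (inj₁ (p<q , d))

  adj⇒D : ∀ {p q} → p < q → Adj p q → D (w p) (w q)
  adj⇒D {p} {q} p<q pq with reflects p q pq
  ... | inj₁ (_ , d)   = d
  ... | inj₂ (q<p , _) = contradiction q<p (<-asym p<q)

  sameLetter-below : ∀ {t p q} → t < p → t < q → w p ≡ w q → Adj t p → Adj t q
  sameLetter-below t<p t<q wp≡wq tp = D⇒adj t<q (subst (D _) wp≡wq (adj⇒D t<p tp))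

  sameLetter-above : ∀ {t p q} → p < t → q < t → w p ≡ w q → Adj t p → Adj t q
  sameLetter-above p<t q<t wp≡wq tp =
    adj-sym (D⇒adj q<t (subst (λ c → D c (w _)) wp≡wq (adj⇒D p<t (adj-sym tp))))

  sees-alike-⊥ : ∀ {p q t} → p ≢ q → (Adj t p → Adj t q) → (Adj t q → Adj t p)
    → Adj t p ⊎ Adj t q → ⊥
  sees-alike-⊥ p≢q to from (inj₁ tp) = p≢q (adj-unique tp (to tp))
  sees-alike-⊥ p≢q to from (inj₂ tq) = p≢q (adj-unique (from tq) tq)

  -- If p < q share a letter and are not adjacent, any neighbour t of p or q
  -- lies strictly between them: from outside, t would see both of them alike.
  partner-between : ∀ {p q t} → p < q → w p ≡ w q → ¬ Adj p q
    → Adj t p ⊎ Adj t q → p < t × t < q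
  partner-between {p} {q} {t} p<q wp≡wq ¬pq tpq with <-cmp t p
  ... | tri< t<p _ _ = ⊥-elim (sees-alike-⊥ (<⇒≢ p<q)
          (sameLetter-below t<p (<-trans t<p p<q) wp≡wq)
          (sameLetter-below (<-trans t<p p<q) t<p (sym wp≡wq)) tpq)
  ... | tri≈ _ refl _ = ⊥-elim ([ adj-irrefl , ¬pq ] tpq)
  ... | tri> _ _ p<t with <-cmp t q
  ...   | tri< t<q _ _  = p<t , t<q
  ...   | tri≈ _ refl _ = ⊥-elim ([ ¬pq ∘ adj-sym , adj-irrefl ] tpq)
  ...   | tri> _ _ q<t  = ⊥-elim (sees-alike-⊥ (<⇒≢ p<q)
          (sameLetter-above p<t q<t wp≡wq)
          (sameLetter-above q<t p<t (sym wp≡wq)) tpq)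

  -- The outer pairs are not adjacent
  -- (the outer vertex would see both others alike), which traps the partner
  -- of the middle vertex both before and after it.
  no-three-occurrences : ∀ {x y z} → x < y → y < z → w x ≡ w y → w y ≡ w z → ⊥
  no-three-occurrences {x} {y} {z} x<y y<z wx≡wy wy≡wz =
    <-asym (proj₂ (partner-between x<y wx≡wy ¬xy (inj₂ y′y)))
           (proj₁ (partner-between y<z wy≡wz ¬yz (inj₁ y′y)))
    where
    x<z = <-trans x<y y<z
    y′y : Adj (partner y) y
    y′y = adj-sym (partner-adj y)
    ¬xy : ¬ Adj x y
    ¬xy xy = <⇒≢ y<z (adj-unique xy (sameLetter-below x<y x<z wy≡wz xy))
    ¬yz : ¬ Adj y z
    ¬yz yz = <⇒≢ x<y (adj-unique (sameLetter-above y<z x<z (sym wx≡wy) zy) zy)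
      where zy = adj-sym yz

  EarlierOccurrence : Fin n → Set
  EarlierOccurrence p = ∃ λ q → q < p × w q ≡ w p

  earlier? : ∀ p → Dec (EarlierOccurrence p)
  earlier? p = any? (λ q → (q <? p) ×-dec (w q ≟ w p))

  label : Fin n → rK₂Vertex r
  label p = w p , indicator (earlier? p)

  -- By Step 1, vertices p < q never share a label: that would give a third
  -- occurrence of their letter before p.
  label-collision : ∀ {p q} → p < q → label p ≡ label q → ⊥
  label-collision {p} {q} p<q eq =
    let x , x<p , wx≡wp = indicator-one (earlier? p) (trans (cong proj₂ eq) q-repeats)
    in no-three-occurrences x<p p<q wx≡wp wp≡wq
    where
    wp≡wq = cong proj₁ eq
    q-repeats = indicator-yes (earlier? q) (p , p<q , wp≡wq)

  label-injective : Injective _≡_ _≡_ label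
  label-injective {p} {q} eq with <-cmp p q
  ... | tri< p<q _ _ = ⊥-elim (label-collision p<q eq)
  ... | tri≈ _ p≡q _ = p≡q
  ... | tri> _ _ q<p = ⊥-elim (label-collision q<p (sym eq))

  TwoOccurrences : Fin r → Set
  TwoOccurrences a = ∃ λ s → ∃ λ t → t < s × w t ≡ a × w s ≡ a

  -- Since there are as many labels as vertices, every label is used; in
  -- particular every letter occurs twice.
  second-occurrence : ∀ a → TwoOccurrences a
  second-occurrence a =
    let s , labelled = injective-into-equinumerous⇒onto bij label label-injective (a , suc zero)
        t , t<s , wt≡ws = indicator-one (earlier? s) (cong proj₂ labelled)
        ws≡a = cong proj₁ labelled
    in s , t , t<s , trans wt≡ws ws≡a , ws≡a

  another-occurrence : ∀ a u → ∃ λ x → x ≢ u × w x ≡ a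
  another-occurrence a u = avoid-u (second-occurrence a)
    where
    avoid-u : TwoOccurrences a → ∃ λ x → x ≢ u × w x ≡ a
    avoid-u (s , t , t<s , wt≡a , ws≡a) with s ≟ u
    ... | no s≢u   = s , s≢u , ws≡a
    ... | yes refl = t , <⇒≢ t<s , wt≡a

  Bad : Fin n → Set
  Bad p = ∃ λ q → p < q × w p ≡ w q × ¬ Adj p q

  -- The partner p′ of p lies between p and q; the other occurrence x of its
  -- letter is not adjacent to p′, and p lies between x and p′, so x < p is bad.
  bad-descent : ∀ {p} → Bad p → ∃ λ x → x < p × Bad x
  bad-descent {p} (q , p<q , wp≡wq , ¬pq) = descend (another-occurrence (w p′) p′)
    where
    p′ = partner p
    p<p′<q = partner-between p<q wp≡wq ¬pq (inj₁ (adj-sym (partner-adj p)))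
    -- a neighbour of p′ is p, whose letter cannot occur a third time
    ¬adj-p′ : ∀ {x} → w x ≡ w p′ → ¬ Adj x p′
    ¬adj-p′ wx≡wp′ xp′ with adj-unique (adj-sym xp′) (adj-sym (partner-adj p))
    ... | refl =
      no-three-occurrences (proj₁ p<p′<q) (proj₂ p<p′<q) wx≡wp′ (trans (sym wx≡wp′) wp≡wq)
    descend : (∃ λ x → x ≢ p′ × w x ≡ w p′) → ∃ λ x → x < p × Bad x
    descend (x , x≢p′ , wx≡wp′) with <-cmp x p′
    ... | tri< x<p′ _ _ = x ,
      proj₁ (partner-between x<p′ wx≡wp′ (¬adj-p′ wx≡wp′) (inj₂ (partner-adj p))) ,
      p′ , x<p′ , wx≡wp′ , ¬adj-p′ wx≡wp′
    ... | tri≈ _ x≡p′ _ = ⊥-elim (x≢p′ x≡p′)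
    ... | tri> _ _ p′<x = ⊥-elim (<-asym (proj₁ p<p′<q)
      (proj₁ (partner-between p′<x (sym wx≡wp′) (¬adj-p′ wx≡wp′ ∘ adj-sym) (inj₁ (partner-adj p)))))

  no-bad : ∀ p → Acc _<_ p → ¬ Bad p
  no-bad p (acc smaller) bad =
    let x , x<p , bad-x = bad-descent bad in no-bad x (smaller x<p) bad-x

  ordered-sameLetter⇒sameEdge : ∀ {p q} → p < q → w p ≡ w q → edge p ≡ edge q
  ordered-sameLetter⇒sameEdge {p} {q} p<q wp≡wq with edge p ≟ edge q
  ... | yes same  = same
  ... | no differ = ⊥-elim (no-bad p (<-wellFounded p) (q , p<q , wp≡wq , differ ∘ proj₁))

  sameLetter⇒sameEdge : ∀ {p q} → w p ≡ w q → edge p ≡ edge q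
  sameLetter⇒sameEdge {p} {q} wp≡wq with <-cmp p q
  ... | tri< p<q _ _  = ordered-sameLetter⇒sameEdge p<q wp≡wq
  ... | tri≈ _ refl _ = refl
  ... | tri> _ _ q<p  = sym (ordered-sameLetter⇒sameEdge q<p (sym wp≡wq))

  -- Step 4: the letter a is carried by two vertices t < s, both on the edge
  -- of s; since that edge has no other vertex, the a-vertices are exactly its endpoints.
  letter-encodes-edge : ∀ a → ∃ λ i → ∀ p → (w p ≡ a) ⇔ (edge p ≡ i)
  letter-encodes-edge a = edge-of (second-occurrence a)
    where
    edge-of : TwoOccurrences a → ∃ λ i → ∀ p → (w p ≡ a) ⇔ (edge p ≡ i)
    edge-of (s , t , t<s , wt≡a , ws≡a) = edge s , λ p → mk⇔ (on-edge p) (carries-a p)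
      where
      on-edge : ∀ p → w p ≡ a → edge p ≡ edge s
      on-edge p wp≡a = sameLetter⇒sameEdge (trans wp≡a (sym ws≡a))
      carries-a : ∀ p → edge p ≡ edge s → w p ≡ a
      carries-a p ps = [ (λ p≡s → trans (cong w p≡s) ws≡a) , (λ p≡t → trans (cong w p≡t) wt≡a) ]
        (edge-pair ps (on-edge t wt≡a) (<⇒≢ t<s))

lemma3 : (r : ℕ) → r ≥ 1 → (n : ℕ) → (D : Decoder r) → (w : Fin n → Fin r)
    → (∀ (a : Fin r) → ∃ λ (p : Fin n) → w p ≡ a)
    → (φ : IsoToRK₂ D w)
    → ∀ (a : Fin r) → ∃ λ (i : Fin r)
    → ∀ (p : Fin n) → (w p ≡ a) ⇔ (proj₁ (Inverse.to (IsoToRK₂.bij φ) p) ≡ i)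
lemma3 r _ n D w _ φ = Lettering.letter-encodes-edge D w φ
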